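{- Let $n\ge1$ and $d$ be integers with $|d|\ge2$. The sand dune group $\Sigma(n,d)$ is finite, and the map $c\mapsto (x-1)c$ induces an injective group homomorphism $S(n,d)\to\Sigma(n,d)$, so that $S(n,d)$ is (identified with) a subgroup of $\Sigma(n,d)$. Moreover, for integers $a_1,\dots,a_{n-1}$, the class of $a=\sum_{v=1}^{n-1}a_ve_v$ in $\Sigma(n,d)$ lies in $S(n,d)$ if and only if $\sum_{v=1}^{n-1}v\,a_v\equiv 0\pmod n$.
   Context: In $\mathbb{Q}[x,x^{ -1}]/(x^n-1)$ (exponents mod $n$) put $e_v=x^v-1$ and $\epsilon_v=d\,e_v-e_{dv}$. $\mathcal Z_n$ is the $\mathbb{Z}$-span of $e_1,\dots,e_{n-1}$, $\mathcal E_{n,d}$ the $\mathbb{Z}$-span of $\epsilon_1,\dots,\epsilon_{n-1}$, and $\Sigma(n,d)=\mathcal Z_n/\mathcal E_{n,d}$. With $f_v=dx^v-\sum_{i=0}^{d-1}x^{dv+i}$ for $d\ge2$ and $f_v=dx^v+\sum_{i=0}^{|d|-1}x^{d(v+1)+i}$ for $d\le-2$, $S(n,d)=\mathcal Z_n/\langle f_1,\dots,f_{n-1}\rangle_{\mathbb{Z}}$ (isomorphic to the sandpile group of the generalized de Bruijn, resp. Kautz, graph). -}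

module Defs where

open import Data.Nat as ℕ using (ℕ; zero; suc; NonZero)
open import Data.Fin using (Fin; toℕ)
open import Data.Integer as ℤ using (ℤ; +_; -[1+_]; _%ℕ_)
open import Data.Bool using (if_then_else_)
open import Relation.Nullary.Decidable using (⌊_⌋)
open import Relation.Binary.PropositionalEquality using (_≡_)
open import Data.Product using (Σ; ∃; _×_)

-- Elements of Z[x,x⁻¹]/(xⁿ-1) ⊆ Q[x,x⁻¹]/(xⁿ-1), represented by their
-- coefficient vectors (coefficient of x^i for i = 0..n-1).
-- All objects in the statement have integer coefficients.
Poly : ℕ → Set
Poly n = Fin n → ℤ

module _ {n : ℕ} .{{_ : NonZero n}} where

  _≈P_ : Poly n → Poly n → Set
  p ≈P q = ∀ i → p i ≡ q i

  0P : Poly n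
  0P _ = + 0

  _+P_ : Poly n → Poly n → Poly n
  (p +P q) i = p i ℤ.+ q i

  _-P_ : Poly n → Poly n → Poly n
  (p -P q) i = p i ℤ.- q i

  _•_ : ℤ → Poly n → Poly n
  (c • p) i = c ℤ.* p i

  X : ℤ → Poly n
  X k i = if ⌊ (k %ℕ n) ℕ.≟ toℕ i ⌋ then + 1 else + 0

  ΣP : ℕ → (ℕ → Poly n) → Poly n
  ΣP zero    g = 0P
  ΣP (suc m) g = ΣP m g +P g m

  ΣF : ∀ {m} → (Fin m → Poly n) → Poly n
  ΣF {zero}  g = 0P
  ΣF {suc m} g = g Fin.zero +P ΣF (λ i → g (Fin.suc i))
    where import Data.Fin as Fin

  _⊛_ : Poly n → Poly n → Poly n
  p ⊛ q = ΣF λ i → ΣF λ j → (p i ℤ.* q j) • X (+ (toℕ i ℕ.+ toℕ j))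

  Σ₁ : (ℕ → Poly n) → Poly n
  Σ₁ g = ΣP (ℕ.pred n) (λ j → g (suc j))

  e : ℤ → Poly n
  e v = X v -P X (+ 0)

  ε : ℤ → ℕ → Poly n
  ε d v = (d • e (+ v)) -P e (d ℤ.* + v)

  -- f_v (generalized de Bruijn for d ≥ 2, Kautz for d ≤ -2)
  f : ℤ → ℕ → Poly n
  f (+ k) v = ((+ k) • X (+ v)) -P ΣP k (λ i → X ((+ k) ℤ.* (+ v) ℤ.+ + i))
  f d@(-[1+ k ]) v =
    (d • X (+ v)) +P ΣP (suc k) (λ i → X (d ℤ.* (+ (suc v)) ℤ.+ + i))

  InSpan : (ℕ → Poly n) → Poly n → Set
  InSpan g p = Σ (ℕ → ℤ) λ a → p ≈P Σ₁ (λ v → a v • g v)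

  InZ : Poly n → Set
  InZ = InSpan (λ v → e (+ v))

  InE : ℤ → Poly n → Set
  InE d = InSpan (ε d)

  InF : ℤ → Poly n → Set
  InF d = InSpan (f d)

  -- equality of classes in Σ(n,d) = 𝒵_n/ℰ_{n,d} and S(n,d) = 𝒵_n/⟨f⟩
  _≡Σ[_]_ : Poly n → ℤ → Poly n → Set
  p ≡Σ[ d ] q = InE d (p -P q)

  _≡S[_]_ : Poly n → ℤ → Poly n → Set
  p ≡S[ d ] q = InF d (p -P q)

  mulX-1 : Poly n → Poly n
  mulX-1 c = (X (+ 1) -P X (+ 0)) ⊛ c

  SigmaFinite : ℤ → Set
  SigmaFinite d = Σ ℕ λ k → Σ (Fin k → Poly n) λ r →
    (∀ j → InZ (r j)) × (∀ p → InZ p → ∃ λ j → p ≡Σ[ d ] r j)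

  weightSum : (ℕ → ℤ) → ℤ
  weightSum a = go (ℕ.pred n)
    where
    go : ℕ → ℤ
    go zero = + 0
    go (suc m) = go m ℤ.+ (+ suc m) ℤ.* a (suc m)

module Submission where

-- After some arithmetic
-- modulo n, the key computation is that multiplication by x - 1 is the
-- difference operator c ↦ (c_{k-1} - c_k)_k.  Its linearity and the formulas
-- (x - 1)e_a = e_{a+1} - e_1 - e_a and (x - 1)f_v = ε_{v+1} - ε_v (a telescoping
-- sum) then give, inside the module Cyclic:
--   * (x - 1)⟨f⟩ = ℰ, since ε_n = 0;
--   * (x - 1) is injective on 𝒵_n, since the only constant in 𝒵_n is 0;
--   * the weight Σ_i i·c_i modulo n vanishes on (x - 1)𝒵_n and on ℰ, and conversely
--     every element of 𝒵_n of weight ≡ 0 lies in (x - 1)𝒵_n;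
--   * N·e_k ∈ ℰ for N = |d^s - d^t| ≠ 0, where d^s ≡ d^t (mod n) by pigeonhole, so
--     coefficients can be reduced modulo N and Σ(n,d) has at most N^(n-1) elements.

open import Defs
open import Data.Nat using (ℕ; NonZero; _≤_)
open import Data.Integer using (ℤ; +_; ∣_∣)
open import Data.Integer.Divisibility using (_∣_)
open import Data.Product using (_×_; Σ; ∃; _,_)
open import Function.Bundles using (_⇔_; mk⇔; Equivalence)

open import Data.Nat.Base as ℕ using (zero; suc)
import Data.Nat.Properties as ℕP
import Data.Nat.DivMod as ℕD
import Data.Nat.Divisibility as ℕDiv
open import Data.Integer.Base using (-[1+_]; _%ℕ_; _/ℕ_; _+_; _*_; _-_; -_; _^_)
import Data.Integer.Properties as ℤP
import Data.Integer.DivMod as ℤD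
import Data.Integer.Divisibility.Signed as Signed
open import Data.Integer.Tactic.RingSolver using (solve-∀)
open import Data.Fin.Base using (Fin; toℕ; fromℕ<; zero; suc; funToFin; finToFun)
import Data.Fin.Properties as FP
open import Algebra.Properties.Semiring.Sum ℤP.+-*-semiring
  using (sum; sum-cong-≗; sum-replicate-zero; ∑-distrib-+; *-distribˡ-sum)
open import Data.Bool.Base using (if_then_else_)
open import Data.Sum.Base using ([_,_]′)
open import Data.Empty using (⊥-elim)
open import Relation.Nullary using (yes; no)
open import Relation.Nullary.Decidable using (⌊_⌋)
open import Relation.Binary.PropositionalEquality using (_≡_; _≢_; refl; sym; trans; cong; cong₂; subst; module ≡-Reasoning)
open import Function.Base using (_∘_)

module Cyclic (m : ℕ) where

  n : ℕ
  n = suc m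

  -- Congruence of integers modulo n (a record, so that a and b are inferable).
  infix 4 _≡ₙ_
  record _≡ₙ_ (a b : ℤ) : Set where
    constructor ≡ₙ-by
    field n∣diff : + n Signed.∣ a - b
  open _≡ₙ_

  ≡ₙ-reflexive : ∀ {a b} → a ≡ b → a ≡ₙ b
  ≡ₙ-reflexive {a} refl = ≡ₙ-by (Signed.divides (+ 0) (ℤP.+-inverseʳ a))

  ≡ₙ-refl : ∀ a → a ≡ₙ a
  ≡ₙ-refl a = ≡ₙ-reflexive refl

  ≡ₙ-sym : ∀ {a b} → a ≡ₙ b → b ≡ₙ a
  ≡ₙ-sym {a} {b} p = ≡ₙ-by (subst (+ n Signed.∣_) (eq a b) (Signed.∣m⇒∣-m (n∣diff p)))
    where
    eq : ∀ a b → - (a - b) ≡ b - a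
    eq = solve-∀

  ≡ₙ-trans : ∀ {a b c} → a ≡ₙ b → b ≡ₙ c → a ≡ₙ c
  ≡ₙ-trans {a} {b} {c} p q = ≡ₙ-by (subst (+ n Signed.∣_) (eq a b c) (Signed.∣m∣n⇒∣m+n (n∣diff p) (n∣diff q)))
    where
    eq : ∀ a b c → (a - b) + (b - c) ≡ a - c
    eq = solve-∀

  ≡ₙ-+ : ∀ {a b c d} → a ≡ₙ b → c ≡ₙ d → a + c ≡ₙ b + d
  ≡ₙ-+ {a} {b} {c} {d} p q = ≡ₙ-by (subst (+ n Signed.∣_) (eq a b c d) (Signed.∣m∣n⇒∣m+n (n∣diff p) (n∣diff q)))
    where
    eq : ∀ a b c d → (a - b) + (c - d) ≡ (a + c) - (b + d)
    eq = solve-∀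

  ≡ₙ-*ˡ : ∀ u {a b} → a ≡ₙ b → u * a ≡ₙ u * b
  ≡ₙ-*ˡ u {a} {b} p = ≡ₙ-by (subst (+ n Signed.∣_) (eq u a b) (Signed.∣n⇒∣m*n u (n∣diff p)))
    where
    eq : ∀ u a b → u * (a - b) ≡ u * a - u * b
    eq = solve-∀

  ≡ₙ-neg : ∀ {a b} → a ≡ₙ b → - a ≡ₙ - b
  ≡ₙ-neg {a} {b} p = ≡ₙ-by (subst (+ n Signed.∣_) (eq a b) (Signed.∣m⇒∣-m (n∣diff p)))
    where
    eq : ∀ a b → - (a - b) ≡ - a - - b
    eq = solve-∀

  ≡ₙ-- : ∀ {a b c d} → a ≡ₙ b → c ≡ₙ d → a - c ≡ₙ b - d
  ≡ₙ-- p q = ≡ₙ-+ p (≡ₙ-neg q)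

  ≡ₙ-*ʳ : ∀ u {a b} → a ≡ₙ b → a * u ≡ₙ b * u
  ≡ₙ-*ʳ u {a} {b} a≡b = ≡ₙ-trans (≡ₙ-reflexive (ℤP.*-comm a u)) (≡ₙ-trans (≡ₙ-*ˡ u a≡b) (≡ₙ-reflexive (ℤP.*-comm u b)))

  n≡ₙ0 : + n ≡ₙ + 0
  n≡ₙ0 = ≡ₙ-by (Signed.divides (+ 1) (eq (+ n)))
    where
    eq : ∀ x → x - + 0 ≡ + 1 * x
    eq = solve-∀

  ≡ₙ-%ℕ : ∀ a → a ≡ₙ + (a %ℕ n)
  ≡ₙ-%ℕ a = ≡ₙ-by (Signed.divides (a /ℕ n)
    (trans (cong (_- + (a %ℕ n)) (ℤD.a≡a%ℕn+[a/ℕn]*n a n)) (cancel (+ (a %ℕ n)) (a /ℕ n * + n))))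
    where
    cancel : ∀ r t → (r + t) - r ≡ t
    cancel = solve-∀

  remainder-unique : ∀ {r s} → r ℕ.< n → s ℕ.< n → + r ≡ₙ + s → r ≡ s
  remainder-unique {r} {s} r<n s<n r≡s with ∣ + r - + s ∣ in dist
  ... | zero  = ℤP.+-injective (ℤP.i-j≡0⇒i≡j (+ r) (+ s) (ℤP.∣i∣≡0⇒i≡0 dist))
  ... | suc t = ⊥-elim (ℕDiv.>⇒∤ dist<n (subst (ℕDiv._∣_ n) dist (Signed.∣⇒∣ᵤ (n∣diff r≡s))))
    where
    dist<n : suc t ℕ.< n
    dist<n = ℕP.≤-<-trans
      (subst (ℕ._≤ r ℕ.⊔ s) (trans (cong ∣_∣ (sym (ℤP.m-n≡m⊖n r s))) dist) (ℤP.∣m⊝n∣≤m⊔n r s))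
      (ℕP.⊔-lub r<n s<n)

  [_] : ℤ → Fin n
  [ a ] = fromℕ< (ℤD.n%ℕd<d a n)

  toℕ-[] : ∀ a → toℕ [ a ] ≡ a %ℕ n
  toℕ-[] a = FP.toℕ-fromℕ< (ℤD.n%ℕd<d a n)

  ≡ₙ-toℕ-[] : ∀ a → + toℕ [ a ] ≡ₙ a
  ≡ₙ-toℕ-[] a = ≡ₙ-sym (subst (λ r → a ≡ₙ + r) (sym (toℕ-[] a)) (≡ₙ-%ℕ a))

  ≡ₙ⇒[]≡ : ∀ {a b} → a ≡ₙ b → [ a ] ≡ [ b ]
  ≡ₙ⇒[]≡ {a} {b} a≡b = FP.toℕ-injective (remainder-unique (FP.toℕ<n [ a ]) (FP.toℕ<n [ b ])
    (≡ₙ-trans (≡ₙ-toℕ-[] a) (≡ₙ-trans a≡b (≡ₙ-sym (≡ₙ-toℕ-[] b)))))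

  []≡⇒≡ₙ : ∀ {a b} → [ a ] ≡ [ b ] → a ≡ₙ b
  []≡⇒≡ₙ {a} {b} eq = ≡ₙ-trans (≡ₙ-sym (≡ₙ-toℕ-[] a))
    (subst (λ i → + toℕ i ≡ₙ b) (sym eq) (≡ₙ-toℕ-[] b))

  [toℕ] : ∀ i → [ + toℕ i ] ≡ i
  [toℕ] i = FP.toℕ-injective (trans (toℕ-[] (+ toℕ i)) (ℕD.m<n⇒m%n≡m (FP.toℕ<n i)))

  []≡⇔≡ₙ : ∀ a i → ([ a ] ≡ i) ⇔ (a ≡ₙ + toℕ i)
  []≡⇔≡ₙ a i = mk⇔ (λ eq → []≡⇒≡ₙ (trans eq (sym ([toℕ] i))))
                   (λ a≡i → trans (≡ₙ⇒[]≡ a≡i) ([toℕ] i))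

  δ : ∀ {k} → Fin k → Fin k → ℤ
  δ zero    zero    = + 1
  δ zero    (suc _) = + 0
  δ (suc _) zero    = + 0
  δ (suc r) (suc i) = δ r i

  δ-refl : ∀ {k} (r : Fin k) → δ r r ≡ + 1
  δ-refl zero    = refl
  δ-refl (suc r) = δ-refl r

  δ-≢ : ∀ {k} {r i : Fin k} → r ≢ i → δ r i ≡ + 0
  δ-≢ {r = zero}  {zero}  r≢i = ⊥-elim (r≢i refl)
  δ-≢ {r = zero}  {suc _} r≢i = refl
  δ-≢ {r = suc _} {zero}  r≢i = refl
  δ-≢ {r = suc r} {suc i} r≢i = δ-≢ (r≢i ∘ cong suc)

  X-δ : ∀ a i → X a i ≡ δ [ a ] i
  X-δ a i with a %ℕ n ℕP.≟ toℕ i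
  ... | yes p = sym (trans (cong (λ r → δ r i) (FP.toℕ-injective (trans (toℕ-[] a) p))) (δ-refl i))
  ... | no ¬p = sym (δ-≢ (λ q → ¬p (trans (sym (toℕ-[] a)) (cong toℕ q))))

  δ-cong : ∀ {k} {r i s j : Fin k} → (r ≡ i → s ≡ j) → (s ≡ j → r ≡ i) → δ r i ≡ δ s j
  δ-cong {r = r} {i} {s} {j} to from with r FP.≟ i
  ... | yes refl = trans (δ-refl r) (sym (δ-≡ (to refl)))
    where
    δ-≡ : s ≡ j → δ s j ≡ + 1
    δ-≡ refl = δ-refl s
  ... | no r≢i = trans (δ-≢ r≢i) (sym (δ-≢ (r≢i ∘ from)))

  X-cong : ∀ {a b} → a ≡ₙ b → X a ≈P X b
  X-cong {a} {b} a≡b i = trans (X-δ a i) (trans (cong (λ r → δ r i) (≡ₙ⇒[]≡ a≡b)) (sym (X-δ b i)))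

  X-dual : ∀ a b i j → (a ≡ₙ + toℕ i → b ≡ₙ + toℕ j) → (b ≡ₙ + toℕ j → a ≡ₙ + toℕ i) →
           X a i ≡ X b j
  X-dual a b i j to from = trans (X-δ a i) (trans (δ-cong
    (λ eq → Equivalence.from ([]≡⇔≡ₙ b j) (to (Equivalence.to ([]≡⇔≡ₙ a i) eq)))
    (λ eq → Equivalence.from ([]≡⇔≡ₙ a i) (from (Equivalence.to ([]≡⇔≡ₙ b j) eq))))
    (sym (X-δ b j)))

  ΣF-eval : ∀ {k} (g : Fin k → Poly n) i → ΣF g i ≡ sum (λ j → g j i)
  ΣF-eval {zero}  g i = refl
  ΣF-eval {suc k} g i = cong (_+_ (g zero i)) (ΣF-eval (g ∘ suc) i)

  sum-zero : ∀ {k} (h : Fin k → ℤ) → (∀ i → h i ≡ + 0) → sum h ≡ + 0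
  sum-zero {k} h h≡0 = trans (sum-cong-≗ h≡0) (sum-replicate-zero k)

  sum-const : ∀ k c → sum {k} (λ _ → c) ≡ + k * c
  sum-const zero    c = sym (ℤP.*-zeroˡ c)
  sum-const (suc k) c = trans (cong (_+_ c) (sum-const k c)) (eq c (+ k))
    where
    eq : ∀ c k → c + k * c ≡ (+ 1 + k) * c
    eq = solve-∀

  sum-δ : ∀ {k} (w : Fin k → ℤ) r → sum (λ i → w i * δ r i) ≡ w r
  sum-δ {suc k} w zero = begin
    w zero * + 1 + sum (λ i → w (suc i) * + 0)
      ≡⟨ cong₂ _+_ (ℤP.*-identityʳ (w zero)) (sum-zero _ (λ i → ℤP.*-zeroʳ (w (suc i)))) ⟩
    w zero + + 0
      ≡⟨ ℤP.+-identityʳ (w zero) ⟩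
    w zero ∎
    where open ≡-Reasoning
  sum-δ {suc k} w (suc r) =
    trans (cong₂ _+_ (ℤP.*-zeroʳ (w zero)) (sum-δ (λ i → w (suc i)) r)) (ℤP.+-identityˡ (w (suc r)))

  -- The pairing ⟨ w , p ⟩ = Σᵢ wᵢ pᵢ of a weight vector with a polynomial.
  -- The coefficient sum, the weight Σᵢ i·pᵢ, and coefficients of products
  -- are all instances of it.
  ⟨_,_⟩ : (Fin n → ℤ) → Poly n → ℤ
  ⟨ w , p ⟩ = sum (λ i → w i * p i)

  ⟨,⟩-comm : ∀ w p → ⟨ w , p ⟩ ≡ ⟨ p , w ⟩
  ⟨,⟩-comm w p = sum-cong-≗ (λ i → ℤP.*-comm (w i) (p i))

  ⟨,⟩-cong : ∀ w {p q} → p ≈P q → ⟨ w , p ⟩ ≡ ⟨ w , q ⟩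
  ⟨,⟩-cong w p≈q = sum-cong-≗ (λ i → cong (w i *_) (p≈q i))

  ⟨,⟩-X : ∀ w a → ⟨ w , X a ⟩ ≡ w [ a ]
  ⟨,⟩-X w a = trans (⟨,⟩-cong w (X-δ a)) (sum-δ w [ a ])

  ⟨,⟩-+ : ∀ w p q → ⟨ w , p +P q ⟩ ≡ ⟨ w , p ⟩ + ⟨ w , q ⟩
  ⟨,⟩-+ w p q = trans (sum-cong-≗ (λ i → ℤP.*-distribˡ-+ (w i) (p i) (q i))) (∑-distrib-+ (λ i → w i * p i) (λ i → w i * q i))

  ⟨,⟩-• : ∀ w c p → ⟨ w , c • p ⟩ ≡ c * ⟨ w , p ⟩
  ⟨,⟩-• w c p = trans (sum-cong-≗ (λ i → eq (w i) c (p i))) (sym (*-distribˡ-sum c (λ i → w i * p i)))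
    where
    eq : ∀ w c p → w * (c * p) ≡ c * (w * p)
    eq = solve-∀

  ⟨,⟩-- : ∀ w p q → ⟨ w , p -P q ⟩ ≡ ⟨ w , p ⟩ - ⟨ w , q ⟩
  ⟨,⟩-- w p q = begin
    ⟨ w , p -P q ⟩              ≡⟨ ⟨,⟩-cong w (λ i → cong (_+_ (p i)) (sym (ℤP.-1*i≡-i (q i)))) ⟩
    ⟨ w , p +P ((- + 1) • q) ⟩    ≡⟨ ⟨,⟩-+ w p ((- + 1) • q) ⟩
    ⟨ w , p ⟩ + ⟨ w , (- + 1) • q ⟩ ≡⟨ cong (_+_ ⟨ w , p ⟩) (trans (⟨,⟩-• w (- + 1) q) (ℤP.-1*i≡-i _)) ⟩
    ⟨ w , p ⟩ - ⟨ w , q ⟩ ∎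
    where open ≡-Reasoning

  X-translate : ∀ (i j k : Fin n) → X (+ (toℕ i ℕ.+ toℕ j)) k ≡ X (+ toℕ k - + toℕ i) j
  X-translate i j k = X-dual (+ (toℕ i ℕ.+ toℕ j)) (K - I) k j to from
    where
    I = + toℕ i
    J = + toℕ j
    K = + toℕ k
    cancel₁ : ∀ I J → (I + J) - I ≡ J
    cancel₁ = solve-∀
    cancel₂ : ∀ I K → I + (K - I) ≡ K
    cancel₂ = solve-∀
    to : + (toℕ i ℕ.+ toℕ j) ≡ₙ K → K - I ≡ₙ J
    to h = ≡ₙ-trans (≡ₙ-- (≡ₙ-sym (subst (_≡ₙ K) (ℤP.pos-+ (toℕ i) (toℕ j)) h)) (≡ₙ-refl I))
                    (≡ₙ-reflexive (cancel₁ I J))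
    from : K - I ≡ₙ J → + (toℕ i ℕ.+ toℕ j) ≡ₙ K
    from h = subst (_≡ₙ K) (sym (ℤP.pos-+ (toℕ i) (toℕ j)))
               (≡ₙ-trans (≡ₙ-+ (≡ₙ-refl I) (≡ₙ-sym h)) (≡ₙ-reflexive (cancel₂ I K)))

  ⊛-eval : ∀ (p c : Poly n) k → (p ⊛ c) k ≡ ⟨ p , (λ i → c [ + toℕ k - + toℕ i ]) ⟩
  ⊛-eval p c k = trans (ΣF-eval (λ i → ΣF (term i)) k) (sum-cong-≗ inner)
    where
    open ≡-Reasoning
    term : Fin n → Fin n → Poly n
    term i j = (p i * c j) • X (+ (toℕ i ℕ.+ toℕ j))
    inner : ∀ i → ΣF (term i) k ≡ p i * c [ + toℕ k - + toℕ i ]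
    inner i = begin
      ΣF (term i) k
        ≡⟨ ΣF-eval (term i) k ⟩
      sum (λ j → p i * c j * X (+ (toℕ i ℕ.+ toℕ j)) k)
        ≡⟨ sum-cong-≗ (λ j → trans (ℤP.*-assoc (p i) (c j) _) (cong (λ t → p i * (c j * t)) (X-translate i j k))) ⟩
      sum (λ j → p i * (c j * X (+ toℕ k - + toℕ i) j))
        ≡⟨ sym (*-distribˡ-sum (p i) (λ j → c j * X (+ toℕ k - + toℕ i) j)) ⟩
      p i * ⟨ c , X (+ toℕ k - + toℕ i) ⟩
        ≡⟨ cong (p i *_) (⟨,⟩-X c (+ toℕ k - + toℕ i)) ⟩
      p i * c [ + toℕ k - + toℕ i ] ∎

  pred : Fin n → Fin n
  pred k = [ + toℕ k - + 1 ]

  mulX-1-eval : ∀ (c : Poly n) k → mulX-1 c k ≡ c (pred k) - c k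
  mulX-1-eval c k = begin
    mulX-1 c k                    ≡⟨ ⊛-eval (X (+ 1) -P X (+ 0)) c k ⟩
    ⟨ X (+ 1) -P X (+ 0) , H ⟩    ≡⟨ ⟨,⟩-comm (X (+ 1) -P X (+ 0)) H ⟩
    ⟨ H , X (+ 1) -P X (+ 0) ⟩    ≡⟨ ⟨,⟩-- H (X (+ 1)) (X (+ 0)) ⟩
    ⟨ H , X (+ 1) ⟩ - ⟨ H , X (+ 0) ⟩ ≡⟨ cong₂ _-_ (⟨,⟩-X H (+ 1)) (⟨,⟩-X H (+ 0)) ⟩
    H [ + 1 ] - H [ + 0 ]         ≡⟨ cong₂ _-_ (cong c (shift (+ 1))) (cong c unshifted) ⟩
    c (pred k) - c k ∎
    where
    open ≡-Reasoning
    K = + toℕ k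
    H : Fin n → ℤ
    H i = c [ K - + toℕ i ]
    shift : ∀ a → [ K - + toℕ [ a ] ] ≡ [ K - a ]
    shift a = ≡ₙ⇒[]≡ (≡ₙ-- (≡ₙ-refl K) (≡ₙ-toℕ-[] a))
    unshifted : [ K - + toℕ [ + 0 ] ] ≡ k
    unshifted = trans (shift (+ 0)) (trans (cong [_] (ℤP.+-identityʳ K)) ([toℕ] k))

  X-shift : ∀ a i → X a (pred i) ≡ X (a + + 1) i
  X-shift a i = X-dual a (a + + 1) (pred i) i to from
    where
    I = + toℕ i
    pred≡ : + toℕ (pred i) ≡ₙ I - + 1
    pred≡ = ≡ₙ-toℕ-[] (I - + 1)
    cancel : ∀ I → (I - + 1) + + 1 ≡ I
    cancel = solve-∀
    uncancel : ∀ a → (a + + 1) - + 1 ≡ a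
    uncancel = solve-∀
    to : a ≡ₙ + toℕ (pred i) → a + + 1 ≡ₙ I
    to h = ≡ₙ-trans (≡ₙ-+ (≡ₙ-trans h pred≡) (≡ₙ-refl (+ 1))) (≡ₙ-reflexive (cancel I))
    from : a + + 1 ≡ₙ I → a ≡ₙ + toℕ (pred i)
    from h = ≡ₙ-trans (≡ₙ-reflexive (sym (uncancel a)))
               (≡ₙ-trans (≡ₙ-- h (≡ₙ-refl (+ 1))) (≡ₙ-sym pred≡))

  M-cong : ∀ {p q} → p ≈P q → mulX-1 p ≈P mulX-1 q
  M-cong {p} {q} p≈q k = trans (mulX-1-eval p k)
    (trans (cong₂ _-_ (p≈q (pred k)) (p≈q k)) (sym (mulX-1-eval q k)))

  M-+ : ∀ p q → mulX-1 (p +P q) ≈P (mulX-1 p +P mulX-1 q)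
  M-+ p q k = trans (mulX-1-eval (p +P q) k)
    (trans (eq (p (pred k)) (q (pred k)) (p k) (q k))
           (sym (cong₂ _+_ (mulX-1-eval p k) (mulX-1-eval q k))))
    where
    eq : ∀ a b c d → (a + b) - (c + d) ≡ (a - c) + (b - d)
    eq = solve-∀

  M-- : ∀ p q → mulX-1 (p -P q) ≈P (mulX-1 p -P mulX-1 q)
  M-- p q k = trans (mulX-1-eval (p -P q) k)
    (trans (eq (p (pred k)) (q (pred k)) (p k) (q k))
           (sym (cong₂ _-_ (mulX-1-eval p k) (mulX-1-eval q k))))
    where
    eq : ∀ a b c d → (a - b) - (c - d) ≡ (a - c) - (b - d)
    eq = solve-∀

  M-• : ∀ c p → mulX-1 (c • p) ≈P (c • mulX-1 p)
  M-• c p k = trans (mulX-1-eval (c • p) k)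
    (trans (eq c (p (pred k)) (p k)) (sym (cong (c *_) (mulX-1-eval p k))))
    where
    eq : ∀ c a b → c * a - c * b ≡ c * (a - b)
    eq = solve-∀

  M-0 : mulX-1 0P ≈P 0P
  M-0 k = mulX-1-eval 0P k

  M-X : ∀ a → mulX-1 (X a) ≈P (X (a + + 1) -P X a)
  M-X a k = trans (mulX-1-eval (X a) k) (cong (_- X a k) (X-shift a k))

  M-e : ∀ a → mulX-1 (e a) ≈P ((e (a + + 1) -P e (+ 1)) -P e a)
  M-e a k = trans (M-- (X a) (X (+ 0)) k)
    (trans (cong₂ _-_ (M-X a k) (M-X (+ 0) k)) (eq (X (a + + 1) k) (X a k) (X (+ 1) k) (X (+ 0) k)))
    where
    eq : ∀ a′ a o z → (a′ - a) - (o - z) ≡ ((a′ - z) - (o - z)) - (a - z)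
    eq = solve-∀

  record Submodule (P : Poly n → Set) : Set where
    field
      resp : ∀ {p q} → p ≈P q → P p → P q
      0∈   : P 0P
      +∈   : ∀ {p q} → P p → P q → P (p +P q)
      •∈   : ∀ c {p} → P p → P (c • p)

    -∈ : ∀ {p q} → P p → P q → P (p -P q)
    -∈ {p} {q} p∈ q∈ = resp (λ i → cong (_+_ (p i)) (ℤP.-1*i≡-i (q i))) (+∈ p∈ (•∈ (- + 1) q∈))

  open Submodule

  Contains : (Poly n → Set) → (ℕ → Poly n) → Set
  Contains P g = ∀ j → j ℕ.< m → P (g (suc j))

  ΣP-∈ : ∀ {P} → Submodule P → ∀ k (g : ℕ → Poly n) → (∀ j → j ℕ.< k → P (g j)) → P (ΣP k g)
  ΣP-∈ S zero    g g∈ = 0∈ S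
  ΣP-∈ S (suc k) g g∈ = +∈ S (ΣP-∈ S k g (λ j j<k → g∈ j (ℕP.m<n⇒m<1+n j<k))) (g∈ k ℕP.≤-refl)

  Σ₁-∈ : ∀ {P} → Submodule P → ∀ g → Contains P g → P (Σ₁ g)
  Σ₁-∈ S g = ΣP-∈ S m (λ j → g (suc j))

  span-least : ∀ {P} → Submodule P → ∀ g → Contains P g → ∀ {p} → InSpan g p → P p
  span-least S g g∈ (a , p≈) = resp S (λ i → sym (p≈ i)) (Σ₁-∈ S (λ v → a v • g v) (λ j j<m → •∈ S (a (suc j)) (g∈ j j<m)))

  ΣP-cong : ∀ k {g h : ℕ → Poly n} → (∀ j → j ℕ.< k → g j ≈P h j) → ΣP k g ≈P ΣP k h
  ΣP-cong zero    g≈h i = refl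
  ΣP-cong (suc k) g≈h i = cong₂ _+_ (ΣP-cong k (λ j j<k → g≈h j (ℕP.m<n⇒m<1+n j<k)) i) (g≈h k ℕP.≤-refl i)

  ΣP-+ : ∀ k (g h : ℕ → Poly n) → (ΣP k g +P ΣP k h) ≈P ΣP k (λ j → g j +P h j)
  ΣP-+ zero    g h i = refl
  ΣP-+ (suc k) g h i = trans (eq (ΣP k g i) (g k i) (ΣP k h i) (h k i)) (cong (_+ (g k i + h k i)) (ΣP-+ k g h i))
    where
    eq : ∀ a b c d → (a + b) + (c + d) ≡ (a + c) + (b + d)
    eq = solve-∀

  ΣP-• : ∀ k c (g : ℕ → Poly n) → (c • ΣP k g) ≈P ΣP k (λ j → c • g j)
  ΣP-• zero    c g i = ℤP.*-zeroʳ c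
  ΣP-• (suc k) c g i = trans (ℤP.*-distribˡ-+ c (ΣP k g i) (g k i)) (cong (_+ (c * g k i)) (ΣP-• k c g i))

  ΣP-- : ∀ k (g h : ℕ → Poly n) → (ΣP k g -P ΣP k h) ≈P ΣP k (λ j → g j -P h j)
  ΣP-- zero    g h i = refl
  ΣP-- (suc k) g h i = trans (eq (ΣP k g i) (g k i) (ΣP k h i) (h k i)) (cong (_+ (g k i - h k i)) (ΣP-- k g h i))
    where
    eq : ∀ a b c d → (a + b) - (c + d) ≡ (a - c) + (b - d)
    eq = solve-∀

  ΣP-0 : ∀ k (g : ℕ → Poly n) → (∀ j → j ℕ.< k → g j ≈P 0P) → ΣP k g ≈P 0P
  ΣP-0 k g g≈0 i = trans (ΣP-cong k g≈0 i) (zeros k i)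
    where
    zeros : ∀ k → ΣP k (λ _ → 0P) ≈P 0P
    zeros zero    i = refl
    zeros (suc k) i = trans (ℤP.+-identityʳ _) (zeros k i)

  ΣP-single : ∀ k (g : ℕ → Poly n) j → j ℕ.< k → (∀ u → u ℕ.< k → u ≢ j → g u ≈P 0P) → ΣP k g ≈P g j
  ΣP-single (suc k) g j j<k others i with j ℕP.≟ k
  ... | yes refl = trans (cong (_+ g k i) (ΣP-0 k g (λ u u<k → others u (ℕP.m<n⇒m<1+n u<k) (λ { refl → ℕP.<-irrefl refl u<k })) i))
                         (ℤP.+-identityˡ (g k i))
  ... | no j≢k = trans (cong₂ _+_ (ΣP-single k g j (ℕP.≤∧≢⇒< (ℕP.≤-pred j<k) j≢k) (λ u u<k → others u (ℕP.m<n⇒m<1+n u<k)) i)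
                                  (others k ℕP.≤-refl (j≢k ∘ sym) i))
                       (ℤP.+-identityʳ (g j i))

  span-submodule : ∀ g → Submodule (InSpan g)
  span-submodule g = record
    { resp = λ { p≈q (a , p≈) → a , λ i → trans (sym (p≈q i)) (p≈ i) }
    ; 0∈   = (λ _ → + 0) , λ i → sym (ΣP-0 m _ (λ j _ i → ℤP.*-zeroˡ (g (suc j) i)) i)
    ; +∈   = λ { (a , p≈) (b , q≈) → (λ v → a v + b v) , λ i →
               trans (cong₂ _+_ (p≈ i) (q≈ i))
                 (trans (ΣP-+ m _ _ i) (ΣP-cong m (λ j _ i → sym (ℤP.*-distribʳ-+ (g (suc j) i) (a (suc j)) (b (suc j)))) i)) }
    ; •∈   = λ { c (a , p≈) → (λ v → c * a v) , λ i →
               trans (cong (c *_) (p≈ i))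
                 (trans (ΣP-• m c _ i) (ΣP-cong m (λ j _ i → sym (ℤP.*-assoc c (a (suc j)) (g (suc j) i))) i)) }
    }

  indicator : ℕ → ℕ → ℤ
  indicator v u = if ⌊ u ℕP.≟ v ⌋ then + 1 else + 0

  indicator-≡ : ∀ v → indicator v v ≡ + 1
  indicator-≡ v with v ℕP.≟ v
  ... | yes _   = refl
  ... | no  v≢v = ⊥-elim (v≢v refl)

  indicator-≢ : ∀ {v u} → u ≢ v → indicator v u ≡ + 0
  indicator-≢ {v} {u} u≢v with u ℕP.≟ v
  ... | yes u≡v = ⊥-elim (u≢v u≡v)
  ... | no  _   = refl

  span-generators : ∀ g → Contains (InSpan g) g
  span-generators g j j<m = indicator (suc j) , λ i → sym (trans
    (ΣP-single m (λ u → indicator (suc j) (suc u) • g (suc u)) j j<m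
       (λ u _ u≢j i → trans (cong (_* g (suc u) i) (indicator-≢ (u≢j ∘ ℕP.suc-injective))) (ℤP.*-zeroˡ (g (suc u) i))) i)
    (trans (cong (_* g (suc j) i) (indicator-≡ (suc j))) (ℤP.*-identityˡ _)))

  preimage : ∀ {P} → Submodule P → Submodule (λ p → P (mulX-1 p))
  preimage S = record
    { resp = λ p≈q → resp S (M-cong p≈q)
    ; 0∈   = resp S (λ i → sym (M-0 i)) (0∈ S)
    ; +∈   = λ {p} {q} p∈ q∈ → resp S (λ i → sym (M-+ p q i)) (+∈ S p∈ q∈)
    ; •∈   = λ c {p} p∈ → resp S (λ i → sym (M-• c p i)) (•∈ S c p∈)
    }

  Image : (Poly n → Set) → Poly n → Set
  Image P q = Σ (Poly n) λ c → P c × (mulX-1 c ≈P q)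

  image : ∀ {P} → Submodule P → Submodule (Image P)
  image S = record
    { resp = λ { q≈q′ (c , c∈ , Mc≈) → c , c∈ , λ i → trans (Mc≈ i) (q≈q′ i) }
    ; 0∈   = 0P , 0∈ S , M-0
    ; +∈   = λ { (c , c∈ , Mc≈) (c′ , c′∈ , Mc′≈) →
               c +P c′ , +∈ S c∈ c′∈ , λ i → trans (M-+ c c′ i) (cong₂ _+_ (Mc≈ i) (Mc′≈ i)) }
    ; •∈   = λ { a (c , c∈ , Mc≈) → a • c , •∈ S a c∈ , λ i → trans (M-• a c i) (cong (a *_) (Mc≈ i)) }
    }

  Z-submodule : Submodule InZ
  Z-submodule = span-submodule (λ v → e (+ v))

  e-cong : ∀ {a b} → a ≡ₙ b → e a ≈P e b
  e-cong a≡b i = cong (_- X (+ 0) i) (X-cong a≡b i)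

  e-0 : ∀ {a} → a ≡ₙ + 0 → e a ≈P 0P
  e-0 a≡0 i = trans (e-cong a≡0 i) (ℤP.+-inverseʳ (X (+ 0) i))

  e∈Z : ∀ a → InZ (e a)
  e∈Z a = resp Z-submodule (e-cong (≡ₙ-toℕ-[] a)) (e-below (toℕ [ a ]) (FP.toℕ<n [ a ]))
    where
    e-below : ∀ r → r ℕ.< n → InZ (e (+ r))
    e-below zero    _   = resp Z-submodule (λ i → sym (e-0 (≡ₙ-refl (+ 0)) i)) (0∈ Z-submodule)
    e-below (suc j) r<n = span-generators (λ v → e (+ v)) j (ℕP.≤-pred r<n)

  M-Z : ∀ {c} → InZ c → InZ (mulX-1 c)
  M-Z = span-least (preimage Z-submodule) (λ v → e (+ v)) λ j _ →
    resp Z-submodule (λ i → sym (M-e (+ suc j) i))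
      (-∈ Z-submodule (-∈ Z-submodule (e∈Z (+ suc j + + 1)) (e∈Z (+ 1))) (e∈Z (+ suc j)))

  ΣP-M : ∀ k (g : ℕ → Poly n) → mulX-1 (ΣP k g) ≈P ΣP k (λ t → mulX-1 (g t))
  ΣP-M zero    g = M-0
  ΣP-M (suc k) g i = trans (M-+ (ΣP k g) (g k) i) (cong (_+ mulX-1 (g k) i) (ΣP-M k g i))

  ΣP-telescope : ∀ k (h : ℕ → Poly n) → ΣP k (λ t → h (suc t) -P h t) ≈P (h k -P h 0)
  ΣP-telescope zero    h i = sym (ℤP.+-inverseʳ (h 0 i))
  ΣP-telescope (suc k) h i = trans (cong (_+ (h (suc k) i - h k i)) (ΣP-telescope k h i))
                                   (eq (h k i) (h 0 i) (h (suc k) i))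
    where
    eq : ∀ a z b → (a - z) + (b - a) ≡ b - z
    eq = solve-∀

  M-geometric : ∀ k b → mulX-1 (ΣP k (λ t → X (b + + t))) ≈P (X (b + + k) -P X b)
  M-geometric k b i = begin
    mulX-1 (ΣP k (λ t → X (b + + t))) i
      ≡⟨ ΣP-M k (λ t → X (b + + t)) i ⟩
    ΣP k (λ t → mulX-1 (X (b + + t))) i
      ≡⟨ ΣP-cong k (λ t _ i → trans (M-X (b + + t) i) (cong (λ z → X z i - X (b + + t) i) (next t))) i ⟩
    ΣP k (λ t → X (b + + suc t) -P X (b + + t)) i
      ≡⟨ ΣP-telescope k (λ t → X (b + + t)) i ⟩
    X (b + + k) i - X (b + + 0) i
      ≡⟨ cong (λ z → X (b + + k) i - X z i) (ℤP.+-identityʳ b) ⟩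
    X (b + + k) i - X b i ∎
    where
    open ≡-Reasoning
    next : ∀ t → b + + t + + 1 ≡ b + + suc t
    next t = trans (ℤP.+-assoc b (+ t) (+ 1)) (cong (λ s → b + + s) (ℕP.+-comm t 1))

  ΣP-X : ∀ k (b : ℕ → ℤ) → ΣP {n} k (λ t → X (b t)) ≈P (ΣP k (λ t → e (b t)) +P ((+ k) • X (+ 0)))
  ΣP-X zero    b i = sym (eq (X (+ 0) i))
    where
    eq : ∀ z → + 0 + + 0 * z ≡ + 0
    eq = solve-∀
  ΣP-X (suc k) b i = trans (cong (_+ X (b k) i) (ΣP-X k b i))
                           (eq (ΣP k (λ t → e (b t)) i) (X (b k) i) (X (+ 0) i) (+ k))
    where
    eq : ∀ S x z k → (S + k * z) + x ≡ (S + (x - z)) + (+ 1 + k) * z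
    eq = solve-∀

  f∈Z : ∀ d v → InZ {n} (f d v)
  f∈Z (+ k) v = resp Z-submodule eq
    (-∈ Z-submodule (•∈ Z-submodule (+ k) (e∈Z (+ v))) (ΣP-∈ Z-submodule k (λ t → e (b t)) (λ t _ → e∈Z (b t))))
    where
    b : ℕ → ℤ
    b t = + k * + v + + t
    shuffle : ∀ K x z S → K * (x - z) - S ≡ K * x - (S + K * z)
    shuffle = solve-∀
    eq : (((+ k) • e (+ v)) -P ΣP k (λ t → e (b t))) ≈P f (+ k) v
    eq i = trans (shuffle (+ k) (X (+ v) i) (X (+ 0) i) (ΣP k (λ t → e (b t)) i))
                 (cong (λ S → + k * X (+ v) i - S) (sym (ΣP-X k b i)))
  f∈Z d@(-[1+ k ]) v = resp Z-submodule eq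
    (+∈ Z-submodule (•∈ Z-submodule d (e∈Z (+ v))) (ΣP-∈ Z-submodule (suc k) (λ t → e (b t)) (λ t _ → e∈Z (b t))))
    where
    b : ℕ → ℤ
    b t = d * + suc v + + t
    shuffle : ∀ K x z S → - K * (x - z) + S ≡ - K * x + (S + K * z)
    shuffle = solve-∀
    eq : ((d • e (+ v)) +P ΣP (suc k) (λ t → e (b t))) ≈P f d v
    eq i = trans (shuffle (+ suc k) (X (+ v) i) (X (+ 0) i) (ΣP (suc k) (λ t → e (b t)) i))
                 (cong (λ S → d * X (+ v) i + S) (sym (ΣP-X (suc k) b i)))

  M-f : ∀ d v → mulX-1 {n} (f d v) ≈P (ε d (suc v) -P ε d v)
  M-f (+ k) v i = begin
    mulX-1 (f (+ k) v) i
      ≡⟨ M-- (K • X V) (ΣP k (λ t → X (K * V + + t))) i ⟩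
    mulX-1 (K • X V) i - mulX-1 (ΣP k (λ t → X (K * V + + t))) i
      ≡⟨ cong₂ _-_ (trans (M-• K (X V) i) (cong (K *_) (M-X V i))) (M-geometric k (K * V) i) ⟩
    K * (X (V + + 1) i - X V i) - (X (K * V + K) i - X (K * V) i)
      ≡⟨ cong₂ (λ a b → K * (X a i - X V i) - (X b i - X (K * V) i)) (cong +_ (ℕP.+-comm v 1)) (sym (spread K V)) ⟩
    K * (X (+ suc v) i - X V i) - (X (K * + suc v) i - X (K * V) i)
      ≡⟨ regroup K (X (+ suc v) i) (X V i) (X (K * + suc v) i) (X (K * V) i) (X (+ 0) i) ⟩
    ε (+ k) (suc v) i - ε (+ k) v i ∎
    where
    open ≡-Reasoning
    K = + k
    V = + v
    spread : ∀ K V → K * (+ 1 + V) ≡ K * V + K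
    spread = solve-∀
    regroup : ∀ K a b c d z → K * (a - b) - (c - d) ≡ (K * (a - z) - (c - z)) - (K * (b - z) - (d - z))
    regroup = solve-∀
  M-f d@(-[1+ k ]) v i = begin
    mulX-1 (f d v) i
      ≡⟨ M-+ (d • X V) (ΣP (suc k) (λ t → X (d * + suc v + + t))) i ⟩
    mulX-1 (d • X V) i + mulX-1 (ΣP (suc k) (λ t → X (d * + suc v + + t))) i
      ≡⟨ cong₂ _+_ (trans (M-• d (X V) i) (cong (d *_) (M-X V i))) (M-geometric (suc k) (d * + suc v) i) ⟩
    d * (X (V + + 1) i - X V i) + (X (d * + suc v + + suc k) i - X (d * + suc v) i)
      ≡⟨ cong₂ (λ a b → d * (X a i - X V i) + (X b i - X (d * + suc v) i)) (cong +_ (ℕP.+-comm v 1)) (absorb (+ suc k) V) ⟩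
    d * (X (+ suc v) i - X V i) + (X (d * V) i - X (d * + suc v) i)
      ≡⟨ regroup d (X (+ suc v) i) (X V i) (X (d * V) i) (X (d * + suc v) i) (X (+ 0) i) ⟩
    ε d (suc v) i - ε d v i ∎
    where
    open ≡-Reasoning
    V = + v
    absorb : ∀ K V → - K * (+ 1 + V) + K ≡ - K * V
    absorb = solve-∀
    regroup : ∀ D a b c d z → D * (a - b) + (c - d) ≡ (D * (a - z) - (d - z)) - (D * (b - z) - (c - z))
    regroup = solve-∀

  pairing-pullback : ∀ w (Q : ℤ → Set) → (∀ {a b} → a ≡ b → Q a → Q b) → Q (+ 0) →
                     (∀ {a b} → Q a → Q b → Q (a + b)) → (∀ c {a} → Q a → Q (c * a)) →
                     Submodule (λ p → Q ⟨ w , p ⟩)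
  pairing-pullback w Q Q-resp Q-0 Q-+ Q-* = record
    { resp = λ p≈q → Q-resp (⟨,⟩-cong w p≈q)
    ; 0∈   = Q-resp (sym (sum-zero _ (λ i → ℤP.*-zeroʳ (w i)))) Q-0
    ; +∈   = λ {p} {q} p∈ q∈ → Q-resp (sym (⟨,⟩-+ w p q)) (Q-+ p∈ q∈)
    ; •∈   = λ c {p} p∈ → Q-resp (sym (⟨,⟩-• w c p)) (Q-* c p∈)
    }

  total : Poly n → ℤ
  total p = ⟨ (λ _ → + 1) , p ⟩

  total-Z : ∀ {c} → InZ c → total c ≡ + 0
  total-Z = span-least
    (pairing-pullback (λ _ → + 1) (_≡ + 0) (λ a≡b a≡0 → trans (sym a≡b) a≡0) refl
      (λ a≡0 b≡0 → cong₂ _+_ a≡0 b≡0) (λ c a≡0 → trans (cong (c *_) a≡0) (ℤP.*-zeroʳ c)))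
    (λ v → e (+ v))
    (λ j _ → trans (⟨,⟩-- (λ _ → + 1) (X (+ suc j)) (X (+ 0))) (cong₂ _-_ (⟨,⟩-X (λ _ → + 1) (+ suc j)) (⟨,⟩-X (λ _ → + 1) (+ 0))))

  -- Multiplication by x - 1 is injective on 𝒵_n: its kernel consists of the
  -- constant polynomials, and the only constant in 𝒵_n is 0.
  M-kernel : ∀ {c} → InZ c → mulX-1 c ≈P 0P → c ≈P 0P
  M-kernel {c} c∈Z Mc≈0 i = trans (trans (cong c (sym ([toℕ] i))) (constant (toℕ i))) c₀≡0
    where
    invariant : ∀ a → c [ a - + 1 ] ≡ c [ a ]
    invariant a = trans (cong c (≡ₙ⇒[]≡ (≡ₙ-- (≡ₙ-sym (≡ₙ-toℕ-[] a)) (≡ₙ-refl (+ 1)))))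
                        (ℤP.i-j≡0⇒i≡j _ _ (trans (sym (mulX-1-eval c [ a ])) (Mc≈0 [ a ])))
    constant : ∀ t → c [ + t ] ≡ c [ + 0 ]
    constant zero    = refl
    constant (suc t) = trans (sym (invariant (+ suc t))) (constant t)
    constant-sum : sum (λ (_ : Fin n) → c [ + 0 ]) ≡ total c
    constant-sum = sum-cong-≗ {n} {λ _ → c [ + 0 ]} {λ j → + 1 * c j} pointwise
      where
      pointwise : ∀ j → c [ + 0 ] ≡ + 1 * c j
      pointwise j = trans (sym (constant (toℕ j))) (trans (cong c ([toℕ] j)) (sym (ℤP.*-identityˡ (c j))))
    total≡0 : total c ≡ + 0
    total≡0 = total-Z {c} c∈Z
    n·c₀≡0 : + n * c [ + 0 ] ≡ + 0
    n·c₀≡0 = trans (sym (sum-const n (c [ + 0 ]))) (trans constant-sum total≡0)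
    c₀≡0 : c [ + 0 ] ≡ + 0
    c₀≡0 = [ (λ ()) , (λ c₀≡0 → c₀≡0) ]′ (ℤP.i*j≡0⇒i≡0∨j≡0 (+ n) n·c₀≡0)

  weight : Poly n → ℤ
  weight p = ⟨ (λ i → + toℕ i) , p ⟩

  weight-e : ∀ a → weight (e a) ≡ₙ a
  weight-e a = ≡ₙ-trans (≡ₙ-reflexive difference) (≡ₙ-trans (≡ₙ-- (≡ₙ-toℕ-[] a) (≡ₙ-refl (+ 0))) (≡ₙ-reflexive (ℤP.+-identityʳ a)))
    where
    difference : weight (e a) ≡ + toℕ [ a ] - + toℕ [ + 0 ]
    difference = trans (⟨,⟩-- (λ i → + toℕ i) (X a) (X (+ 0))) (cong₂ _-_ (⟨,⟩-X (λ i → + toℕ i) a) (⟨,⟩-X (λ i → + toℕ i) (+ 0)))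

  Balanced : Poly n → Set
  Balanced p = weight p ≡ₙ + 0

  Balanced-submodule : Submodule Balanced
  Balanced-submodule = pairing-pullback (λ i → + toℕ i) (_≡ₙ + 0) (λ a≡b → ≡ₙ-trans (≡ₙ-reflexive (sym a≡b))) (≡ₙ-refl (+ 0))
    (λ a≡0 b≡0 → ≡ₙ-+ a≡0 b≡0) (λ c a≡0 → ≡ₙ-trans (≡ₙ-*ˡ c a≡0) (≡ₙ-reflexive (ℤP.*-zeroʳ c)))

  M-balanced : ∀ {c} → InZ c → Balanced (mulX-1 c)
  M-balanced = span-least (preimage Balanced-submodule) (λ v → e (+ v)) λ j _ →
    resp Balanced-submodule (λ i → sym (M-e (+ suc j) i)) (balanced (+ suc j))
    where
    cancel : ∀ a → ((a + + 1) - + 1) - a ≡ + 0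
    cancel = solve-∀
    balanced : ∀ a → Balanced ((e (a + + 1) -P e (+ 1)) -P e a)
    balanced a = ≡ₙ-trans (≡ₙ-reflexive (trans (⟨,⟩-- (λ i → + toℕ i) (e (a + + 1) -P e (+ 1)) (e a))
                                               (cong (_- weight (e a)) (⟨,⟩-- (λ i → + toℕ i) (e (a + + 1)) (e (+ 1))))))
                 (≡ₙ-trans (≡ₙ-- (≡ₙ-- (weight-e (a + + 1)) (weight-e (+ 1))) (weight-e a)) (≡ₙ-reflexive (cancel a)))

  -- The weight of Σ_{v=1}^{k} a_v e_v is Σ_{v=1}^{k} v·a_v modulo n.
  -- (weightSum {k+1} a is the latter sum, whatever the modulus.)
  weight-Σe : ∀ (a : ℕ → ℤ) k → weight (ΣP k (λ j → a (suc j) • e (+ suc j))) ≡ₙ weightSum {suc k} a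
  weight-Σe a zero = ≡ₙ-reflexive weight-0
    where
    weight-0 : weight 0P ≡ + 0
    weight-0 = sum-zero {n} (λ i → + toℕ i * + 0) (λ i → ℤP.*-zeroʳ (+ toℕ i))
  weight-Σe a (suc k) = ≡ₙ-trans (≡ₙ-reflexive split)
    (≡ₙ-trans (≡ₙ-+ (weight-Σe a k) (≡ₙ-*ˡ (a (suc k)) (weight-e (+ suc k)))) (≡ₙ-reflexive swap))
    where
    S : Poly n
    S = ΣP k (λ j → a (suc j) • e (+ suc j))
    split : weight (S +P (a (suc k) • e (+ suc k))) ≡ weight S + a (suc k) * weight (e (+ suc k))
    split = trans (⟨,⟩-+ (λ i → + toℕ i) S (a (suc k) • e (+ suc k)))
                  (cong (_+_ (weight S)) (⟨,⟩-• (λ i → + toℕ i) (a (suc k)) (e (+ suc k))))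
    swap : weightSum {suc k} a + a (suc k) * + suc k ≡ weightSum {suc (suc k)} a
    swap = cong (_+_ (weightSum {suc k} a)) (ℤP.*-comm (a (suc k)) (+ suc k))

  -- gap_v = e_v - v·e_1 lies in (x - 1)·𝒵_n, since gap_{v+1} = gap_v + (x - 1)·e_v.
  gap : ℕ → Poly n
  gap v = e (+ v) -P ((+ v) • e (+ 1))

  gap∈MZ : ∀ v → Image InZ (gap v)
  gap∈MZ zero = resp (image Z-submodule) gap-0 (0∈ (image Z-submodule))
    where
    vanish : ∀ z o → + 0 ≡ (z - z) - + 0 * (o - z)
    vanish = solve-∀
    gap-0 : 0P ≈P gap 0
    gap-0 i = vanish (X (+ 0) i) (X (+ 1) i)
  gap∈MZ (suc v) = resp (image Z-submodule) step
    (+∈ (image Z-submodule) (gap∈MZ v) (e (+ v) , e∈Z (+ v) , λ i → refl))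
    where
    telescope : ∀ xv x1 x0 xs v → ((xv - x0) - v * (x1 - x0)) + (((xs - x0) - (x1 - x0)) - (xv - x0))
                                  ≡ (xs - x0) - (+ 1 + v) * (x1 - x0)
    telescope = solve-∀
    step : (gap v +P mulX-1 (e (+ v))) ≈P gap (suc v)
    step i = trans (cong (_+_ (gap v i)) (M-e (+ v) i))
      (trans (cong (λ s → gap v i + (((X s i - X (+ 0) i) - (X (+ 1) i - X (+ 0) i)) - (X (+ v) i - X (+ 0) i)))
                   (cong +_ (ℕP.+-comm v 1)))
             (telescope (X (+ v) i) (X (+ 1) i) (X (+ 0) i) (X (+ suc v) i) (+ v)))

  -- n·e_1 = -gap_n lies in (x - 1)·𝒵_n as well, because e_n = 0.
  n·e₁∈MZ : Image InZ ((+ n) • e (+ 1))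
  n·e₁∈MZ = resp (image Z-submodule) negate (•∈ (image Z-submodule) (- + 1) (gap∈MZ n))
    where
    flip : ∀ y x → - + 1 * (y - x) ≡ x - y
    flip = solve-∀
    negate : ((- + 1) • gap n) ≈P ((+ n) • e (+ 1))
    negate i = trans (flip (e (+ n) i) ((+ n) * e (+ 1) i))
                     (trans (cong (λ t → + n * e (+ 1) i - t) (e-0 n≡ₙ0 i)) (ℤP.+-identityʳ _))

  decompose : ∀ (a : ℕ → ℤ) k → ΣP k (λ j → a (suc j) • e (+ suc j))
              ≈P (ΣP k (λ j → a (suc j) • gap (suc j)) +P (weightSum {suc k} a • e (+ 1)))
  decompose a zero    i = sym (ℤP.*-zeroˡ (e (+ 1) i))
  decompose a (suc k) i = trans (cong (_+ (a (suc k) * e (+ suc k) i)) (decompose a k i))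
    (regroup (ΣP k (λ j → a (suc j) • gap (suc j)) i) (weightSum {suc k} a) (e (+ 1) i) (a (suc k)) (e (+ suc k) i) (+ suc k))
    where
    regroup : ∀ T w e₁ a eₛ s → (T + w * e₁) + a * eₛ ≡ (T + a * (eₛ - s * e₁)) + (w + s * a) * e₁
    regroup = solve-∀

  balanced⇒image : ∀ (a : ℕ → ℤ) → + n Signed.∣ weightSum {n} a → Image InZ (Σ₁ (λ v → a v • e (+ v)))
  balanced⇒image a (Signed.divides q w≡qn) = resp (image Z-submodule) (λ i → sym (rewrite-Σ i))
    (+∈ (image Z-submodule) (Σ₁-∈ (image Z-submodule) (λ v → a v • gap v) (λ j _ → •∈ (image Z-submodule) (a (suc j)) (gap∈MZ (suc j))))
                            (•∈ (image Z-submodule) q n·e₁∈MZ))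
    where
    rewrite-Σ : Σ₁ (λ v → a v • e (+ v)) ≈P (Σ₁ (λ v → a v • gap v) +P (q • ((+ n) • e (+ 1))))
    rewrite-Σ i = trans (decompose a m i)
      (cong (_+_ (Σ₁ (λ v → a v • gap v) i)) (trans (cong (_* e (+ 1) i) w≡qn) (ℤP.*-assoc q (+ n) (e (+ 1) i))))

  module Degree (d : ℤ) where

    E-submodule : Submodule (InE d)
    E-submodule = span-submodule (ε d)

    F-submodule : Submodule (InF d)
    F-submodule = span-submodule (f d)

    ε′ : ℤ → Poly n
    ε′ a = (d • e a) -P e (d * a)

    ε′-cong : ∀ {a b} → a ≡ₙ b → ε′ a ≈P ε′ b
    ε′-cong a≡b i = cong₂ (λ x y → d * x - y) (e-cong a≡b i) (e-cong (≡ₙ-*ˡ d a≡b) i)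

    ε′-0 : ∀ {a} → a ≡ₙ + 0 → ε′ a ≈P 0P
    ε′-0 a≡0 i = trans (ε′-cong a≡0 i)
      (trans (cong₂ (λ x y → d * x - y) (e-0 (≡ₙ-refl (+ 0)) i) (e-0 (≡ₙ-reflexive (ℤP.*-zeroʳ d)) i)) (vanish d))
      where
      vanish : ∀ d → d * + 0 - + 0 ≡ + 0
      vanish = solve-∀

    ε′∈E : ∀ a → InE d (ε′ a)
    ε′∈E a = resp E-submodule (ε′-cong (≡ₙ-toℕ-[] a)) (below (toℕ [ a ]) (FP.toℕ<n [ a ]))
      where
      below : ∀ r → r ℕ.< n → InE d (ε d r)
      below zero    _   = resp E-submodule (λ i → sym (ε′-0 (≡ₙ-refl (+ 0)) i)) (0∈ E-submodule)
      below (suc j) r<n = span-generators (ε d) j (ℕP.≤-pred r<n)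

    -- (x - 1)·⟨f⟩ ⊆ ℰ, since (x - 1)·f_v = ε_{v+1} - ε_v.
    MF⊆E : ∀ {c} → InF d c → InE d (mulX-1 c)
    MF⊆E = span-least (preimage E-submodule) (f d) λ j _ →
      resp E-submodule (λ i → sym (M-f d (suc j) i)) (-∈ E-submodule (ε′∈E (+ suc (suc j))) (ε′∈E (+ suc j)))

    -- ε_v ∈ (x - 1)·⟨f⟩ by downward induction on v: ε_n = 0 and ε_v = ε_{v+1} - (x - 1)·f_v.
    ε∈MF : ∀ t j → t ℕ.+ suc j ≡ n → Image (InF d) (ε d (suc j))
    ε∈MF zero    j refl = resp (image F-submodule) (λ i → sym (ε′-0 n≡ₙ0 i)) (0∈ (image F-submodule))
    ε∈MF (suc t) j t+1+j≡n = resp (image F-submodule) step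
      (-∈ (image F-submodule) (ε∈MF t (suc j) (trans (ℕP.+-suc t (suc j)) t+1+j≡n))
                              (f d (suc j) , span-generators (f d) j j<m , λ i → refl))
      where
      j<m : j ℕ.< m
      j<m = ℕP.≤-trans (ℕP.m≤n+m (suc j) t) (ℕP.≤-reflexive (ℕP.suc-injective t+1+j≡n))
      cancel : ∀ a b → a - (a - b) ≡ b
      cancel = solve-∀
      step : (ε d (suc (suc j)) -P mulX-1 (f d (suc j))) ≈P ε d (suc j)
      step i = trans (cong (_-_ (ε d (suc (suc j)) i)) (M-f d (suc j) i)) (cancel (ε d (suc (suc j)) i) (ε d (suc j) i))

    E⊆MF : ∀ {p} → InE d p → Image (InF d) p
    E⊆MF = span-least (image F-submodule) (ε d) λ j j<m →
      ε∈MF (m ℕ.∸ j) j (trans (ℕP.+-suc (m ℕ.∸ j) j) (cong suc (ℕP.m∸n+n≡m (ℕP.<⇒≤ j<m))))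

    F⊆Z : ∀ {c} → InF d c → InZ c
    F⊆Z = span-least Z-submodule (f d) (λ j _ → f∈Z d (suc j))

    descends : ∀ c c′ → c ≡S[ d ] c′ → mulX-1 c ≡Σ[ d ] mulX-1 c′
    descends c c′ c≡c′ = resp E-submodule (M-- c c′) (MF⊆E c≡c′)

    -- … and injective: if (x - 1)(c - c′) = (x - 1)g with g ∈ ⟨f⟩, then
    -- c - c′ - g ∈ 𝒵_n lies in the kernel, so c - c′ = g.
    injective : ∀ c c′ → InZ c → InZ c′ → mulX-1 c ≡Σ[ d ] mulX-1 c′ → c ≡S[ d ] c′
    injective c c′ c∈Z c′∈Z Mc≡Mc′ = cancel-preimage (E⊆MF (resp E-submodule (λ i → sym (M-- c c′ i)) Mc≡Mc′))
      where
      w : Poly n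
      w = c -P c′
      cancel-preimage : Image (InF d) (mulX-1 w) → InF d w
      cancel-preimage (g , g∈F , Mg≈Mw) = resp F-submodule g≈w g∈F
        where
        w-g∈Z : InZ (w -P g)
        w-g∈Z = -∈ Z-submodule (-∈ Z-submodule c∈Z c′∈Z) (F⊆Z g∈F)
        M[w-g]≈0 : mulX-1 (w -P g) ≈P 0P
        M[w-g]≈0 i = trans (M-- w g i) (trans (cong (_-_ (mulX-1 w i)) (Mg≈Mw i)) (ℤP.+-inverseʳ (mulX-1 w i)))
        g≈w : g ≈P w
        g≈w i = sym (ℤP.i-j≡0⇒i≡j (w i) (g i) (M-kernel w-g∈Z M[w-g]≈0 i))

    -- ℰ consists of balanced polynomials: weight(d·e_a - e_{da}) ≡ d·a - d·a.
    E-balanced : ∀ {p} → InE d p → Balanced p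
    E-balanced = span-least Balanced-submodule (ε d) λ j _ → ε′-balanced (+ suc j)
      where
      ε′-balanced : ∀ a → Balanced (ε′ a)
      ε′-balanced a = ≡ₙ-trans (≡ₙ-reflexive split)
        (≡ₙ-trans (≡ₙ-- (≡ₙ-*ˡ d (weight-e a)) (weight-e (d * a))) (≡ₙ-reflexive (ℤP.+-inverseʳ (d * a))))
        where
        split : weight (ε′ a) ≡ d * weight (e a) - weight (e (d * a))
        split = trans (⟨,⟩-- (λ i → + toℕ i) (d • e a) (e (d * a))) (cong (_- weight (e (d * a))) (⟨,⟩-• (λ i → + toℕ i) d (e a)))

    image⇒ : ∀ (a : ℕ → ℤ) → (∃ λ c → InZ c × (mulX-1 c ≡Σ[ d ] Σ₁ (λ v → a v • e (+ v)))) → (+ n) ∣ weightSum {n} a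
    image⇒ a (c , c∈Z , Mc≡Σa) = Signed.∣⇒∣ᵤ (subst (+ n Signed.∣_) (ℤP.+-identityʳ (weightSum {n} a)) (n∣diff ws≡0))
      where
      Σa : Poly n
      Σa = Σ₁ (λ v → a v • e (+ v))
      cancel : ∀ x y → x - (x - y) ≡ y
      cancel = solve-∀
      Σa-balanced : Balanced Σa
      Σa-balanced = resp Balanced-submodule (λ i → cancel (mulX-1 c i) (Σa i))
        (-∈ Balanced-submodule {mulX-1 c} {mulX-1 c -P Σa} (M-balanced {c} c∈Z) (E-balanced {mulX-1 c -P Σa} Mc≡Σa))
      ws≡0 : weightSum {n} a ≡ₙ + 0
      ws≡0 = ≡ₙ-trans (≡ₙ-sym (weight-Σe a m)) Σa-balanced

    image⇐ : ∀ (a : ℕ → ℤ) → (+ n) ∣ weightSum {n} a → ∃ λ c → InZ c × (mulX-1 c ≡Σ[ d ] Σ₁ (λ v → a v • e (+ v)))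
    image⇐ a n∣ws = exact-preimage (balanced⇒image a (Signed.∣ᵤ⇒∣ n∣ws))
      where
      exact-preimage : Image InZ (Σ₁ (λ v → a v • e (+ v))) → ∃ λ c → InZ c × (mulX-1 c ≡Σ[ d ] Σ₁ (λ v → a v • e (+ v)))
      exact-preimage (c , c∈Z , Mc≈Σa) =
        c , c∈Z , resp E-submodule (λ i → sym (trans (cong (_- Σ₁ (λ v → a v • e (+ v)) i) (Mc≈Σa i)) (ℤP.+-inverseʳ (Σ₁ (λ v → a v • e (+ v)) i)))) (0∈ E-submodule)

    power∈E : ∀ a k → InE d (((d ^ a) • e k) -P e (d ^ a * k))
    power∈E zero k = resp E-submodule (λ i → sym (vanish i)) (0∈ E-submodule)
      where
      vanish : (((d ^ 0) • e k) -P e (d ^ 0 * k)) ≈P 0P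
      vanish i = trans (cong₂ _-_ (ℤP.*-identityˡ (e k i)) (cong (λ t → e t i) (ℤP.*-identityˡ k)))
                       (ℤP.+-inverseʳ (e k i))
    power∈E (suc a) k = resp E-submodule combine (+∈ E-submodule (•∈ E-submodule d (power∈E a k)) (ε′∈E (D * k)))
      where
      D = d ^ a
      collect : ∀ d D x y z → d * (D * x - y) + (d * y - z) ≡ (d * D) * x - z
      collect = solve-∀
      combine : ((d • ((D • e k) -P e (D * k))) +P ε′ (D * k)) ≈P (((d * D) • e k) -P e (d * D * k))
      combine i = trans (collect d D (e k i) (e (D * k) i) (e (d * (D * k)) i))
                        (cong (λ t → (d * D) * e k i - e t i) (sym (ℤP.*-assoc d D k)))

    record Period : Set where
      field
        t s     : ℕ
        t<s     : t ℕ.< s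
        d^s≡d^t : d ^ s ≡ₙ d ^ t

    period : Period
    period = from-pigeonhole (FP.pigeonhole (ℕP.n<1+n n) (λ t → [ d ^ toℕ t ]))
      where
      from-pigeonhole : (∃ λ i → ∃ λ j → toℕ i ℕ.< toℕ j × [ d ^ toℕ i ] ≡ [ d ^ toℕ j ]) → Period
      from-pigeonhole (i , j , i<j , same) = record
        { t = toℕ i ; s = toℕ j ; t<s = i<j ; d^s≡d^t = []≡⇒≡ₙ (sym same) }

    ∣d^a∣ : ∀ a → ∣ d ^ a ∣ ≡ ∣ d ∣ ℕ.^ a
    ∣d^a∣ zero    = refl
    ∣d^a∣ (suc a) = trans (ℤP.abs-* d (d ^ a)) (cong (∣ d ∣ ℕ.*_) (∣d^a∣ a))

    -- Finiteness of Σ(n,d); this is where |d| ≥ 2 is used.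
    module Finiteness (2≤∣d∣ : 2 ≤ ∣ d ∣) where
      open Period period

      -- x = d^s - d^t is nonzero because |d|^t < |d|^s …
      x : ℤ
      x = d ^ s - d ^ t

      x≢0 : x ≢ + 0
      x≢0 x≡0 = ℕP.<-irrefl equal (ℕP.^-monoʳ-< ∣ d ∣ 2≤∣d∣ t<s)
        where
        equal : ∣ d ∣ ℕ.^ t ≡ ∣ d ∣ ℕ.^ s
        equal = trans (sym (∣d^a∣ t)) (trans (cong ∣_∣ (sym (ℤP.i-j≡0⇒i≡j (d ^ s) (d ^ t) x≡0))) (∣d^a∣ s))

      -- … and x·e_k ∈ ℰ, since e_{d^s k} = e_{d^t k}.
      x•e∈E : ∀ k → InE d (x • e k)
      x•e∈E k = resp E-submodule difference (-∈ E-submodule (power∈E s k) (power∈E t k))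
        where
        factor : ∀ S T u y → (S * u - y) - (T * u - y) ≡ (S - T) * u
        factor = solve-∀
        difference : ((((d ^ s) • e k) -P e (d ^ s * k)) -P (((d ^ t) • e k) -P e (d ^ t * k))) ≈P (x • e k)
        difference i = trans (cong (λ y → (d ^ s * e k i - e (d ^ s * k) i) - (d ^ t * e k i - y))
                                   (sym (e-cong (≡ₙ-*ʳ k d^s≡d^t) i)))
                             (factor (d ^ s) (d ^ t) (e k i) (e (d ^ s * k) i))

      N : ℕ
      N = ∣ x ∣

      instance
        N≢0 : NonZero N
        N≢0 = ℕ.≢-nonZero (x≢0 ∘ ℤP.∣i∣≡0⇒i≡0)

      N•e∈E : ∀ k → InE d ((+ N) • e k)
      N•e∈E k = [ (λ N≡x → resp E-submodule (λ i → cong (_* e k i) (sym N≡x)) (x•e∈E k))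
                , (λ N≡-x → resp E-submodule (λ i → trans (negate x (e k i)) (cong (_* e k i) (sym N≡-x)))
                                   (•∈ E-submodule (- + 1) (x•e∈E k))) ]′ (ℤP.+∣i∣≡i⊎+∣i∣≡-i x)
        where
        negate : ∀ x y → - + 1 * (x * y) ≡ - x * y
        negate = solve-∀

      -- A code b : Fin k → Fin N read as the coefficient list (b₀, b₁, …, b_{k-1}, 0, 0, …).
      digit : ∀ {k} → (Fin k → Fin N) → ℕ → ℤ
      digit {zero}  b u       = + 0
      digit {suc k} b zero    = + toℕ (b zero)
      digit {suc k} b (suc u) = digit (λ i → b (suc i)) u

      digit-fromℕ< : ∀ {k} (b : Fin k → Fin N) u (u<k : u ℕ.< k) → digit b u ≡ + toℕ (b (fromℕ< u<k))
      digit-fromℕ< {suc k} b zero    u<k = refl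
      digit-fromℕ< {suc k} b (suc u) u<k = digit-fromℕ< (λ i → b (suc i)) u (ℕP.≤-pred u<k)

      -- The N^(n-1) representatives Σ_v r_v e_v with 0 ≤ r_v < N.
      representative : Fin (N ℕ.^ m) → Poly n
      representative code = Σ₁ (λ v → digit (finToFun {N} {m} code) (ℕ.pred v) • e (+ v))

      -- Every element of 𝒵_n is congruent modulo ℰ to a representative:
      -- reduce its coefficients modulo N.
      cover : ∀ p → InZ p → ∃ λ code → p ≡Σ[ d ] representative code
      cover p (a , p≈) = funToFin b , resp E-submodule (λ i → sym (difference i)) (Σ₁-∈ E-submodule h h∈E)
        where
        b : Fin m → Fin N
        b t = fromℕ< (ℤD.n%ℕd<d (a (suc (toℕ t))) N)
        r : ℕ → ℤ
        r v = digit (finToFun {N} {m} (funToFin b)) (ℕ.pred v)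
        h : ℕ → Poly n
        h v = (a v • e (+ v)) -P (r v • e (+ v))
        difference : (p -P representative (funToFin b)) ≈P Σ₁ h
        difference i = trans (cong (_- representative (funToFin b) i) (p≈ i))
                             (ΣP-- m (λ j → a (suc j) • e (+ suc j)) (λ j → r (suc j) • e (+ suc j)) i)
        r≡remainder : ∀ j → j ℕ.< m → r (suc j) ≡ + (a (suc j) %ℕ N)
        r≡remainder j j<m = trans (digit-fromℕ< (finToFun (funToFin b)) j j<m)
          (cong +_ (trans (cong toℕ (FP.finToFun-funToFin b (fromℕ< j<m)))
                   (trans (FP.toℕ-fromℕ< (ℤD.n%ℕd<d (a (suc (toℕ (fromℕ< j<m)))) N))
                          (cong (λ u → a (suc u) %ℕ N) (FP.toℕ-fromℕ< j<m)))))
        quotient : ∀ r q N y → (r + q * N) * y - r * y ≡ q * (N * y)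
        quotient = solve-∀
        h∈E : Contains (InE d) h
        h∈E j j<m = resp E-submodule multiple (•∈ E-submodule (a (suc j) /ℕ N) (N•e∈E (+ suc j)))
          where
          multiple : ((a (suc j) /ℕ N) • ((+ N) • e (+ suc j))) ≈P h (suc j)
          multiple i = sym (trans (cong₂ (λ α ρ → α * e (+ suc j) i - ρ * e (+ suc j) i)
                                         (ℤD.a≡a%ℕn+[a/ℕn]*n (a (suc j)) N) (r≡remainder j j<m))
                                  (quotient (+ (a (suc j) %ℕ N)) (a (suc j) /ℕ N) (+ N) (e (+ suc j) i)))

      representative∈Z : ∀ code → InZ (representative code)
      representative∈Z code = (λ v → digit (finToFun {N} {m} code) (ℕ.pred v)) , λ i → refl

      finite : SigmaFinite {n} d
      finite = N ℕ.^ m , representative , representative∈Z , cover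

theorem2p5 : (n : ℕ) .{{_ : NonZero n}} (d : ℤ) → 2 ≤ ∣ d ∣ →
    SigmaFinite {n} d
    × (∀ c → InZ c → InZ (mulX-1 c))
    × (∀ c c′ → mulX-1 (c +P c′) ≈P (mulX-1 c +P mulX-1 c′))
    × (∀ c c′ → InZ c → InZ c′ → c ≡S[ d ] c′ → mulX-1 c ≡Σ[ d ] mulX-1 c′)
    × (∀ c c′ → InZ c → InZ c′ → mulX-1 c ≡Σ[ d ] mulX-1 c′ → c ≡S[ d ] c′)
    × (∀ (a : ℕ → ℤ) →
         (∃ λ c → InZ c × (mulX-1 c ≡Σ[ d ] Σ₁ (λ v → a v • e (+ v))))
         ⇔ ((+ n) ∣ weightSum {n} a))
-- The case n = 0 is excluded by the NonZero instance.
theorem2p5 zero    d 2≤∣d∣ = ⊥-elim (ℕ.≢-nonZero⁻¹ 0 refl)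
theorem2p5 (suc m) d 2≤∣d∣ =
  finite , (λ c → M-Z) , M-+ , (λ c c′ _ _ → descends c c′) , injective , λ a → mk⇔ (image⇒ a) (image⇐ a)
  where
  open Cyclic m
  open Degree d
  open Finiteness 2≤∣d∣
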